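{- Let $n$ be a positive integer. For $\bar\epsilon=(\epsilon_1,\dots,\epsilon_{n-1})\in\{0,1\}^{n-1}$ let $w_S(n,\bar\epsilon)$ be the number of $w\in S_n$ with $\bar\epsilon_S(w)=\bar\epsilon$ and $w_A(n,\bar\epsilon)$ the number of $v\in A_{n+1}$ with $\bar\epsilon_A(v)=\bar\epsilon$, and write $t^{\bar\epsilon}=\prod_j t_j^{\epsilon_j}$. Then (1) $\sum_{\bar\epsilon}w_S(n,\bar\epsilon)t^{\bar\epsilon}=(t_1+1)(t_2+2)\cdots(t_{n-1}+n-1)$; (2) $\sum_{\bar\epsilon}w_A(n,\bar\epsilon)t^{\bar\epsilon}=(2t_1+1)(2t_2+2)\cdots(2t_{n-1}+n-1)$.
   Context: Permutations are multiplied as functions; $s_i=(i,i+1)$. $R^S_j=\{1,s_j,\dots,s_j\cdots s_1\}$; every $w\in S_n$ factors uniquely as $w_1\cdots w_{n-1}$, $w_j\in R^S_j$; $\bar\epsilon_S(w)=(\epsilon_{S,1}(w),\dots,\epsilon_{S,n-1}(w))$ where $\epsilon_{S,j}(w)=1$ if $w_j=s_j\cdots s_1$ and $0$ otherwise. In $S_{n+1}$, $a_i=s_1s_{i+1}$ ($1\le i\le n-1$), $R^A_j=\{1,a_j,a_ja_{j-1},\dots,a_j\cdots a_2,a_j\cdots a_2a_1,a_j\cdots a_2a_1^{ -1}\}$ ($R^A_1=\{1,a_1,a_1^{ -1}\}$); every $v\in A_{n+1}$ factors uniquely as $v_1\cdots v_{n-1}$, $v_j\in R^A_j$; $\bar\epsilon_A(v)=(\epsilon_{A,1}(v),\dots,\epsilon_{A,n-1}(v))$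 with $\epsilon_{A,j}(v)=1$ if $a_1^{\pm1}$ occurs in $v_j$, else $0$. -}

module Defs where

open import Level using (Level)
open import Data.Bool using (Bool; true; false; _∧_; if_then_else_)
open import Data.Nat using (ℕ; zero; suc; _∸_; _≡ᵇ_; _≤ᵇ_; _%_)
open import Data.Fin using (Fin; zero; suc; _<?_)
open import Data.Vec using (Vec; []; _∷_; _∷ʳ_; tabulate; lookup)
import Data.Vec as Vec
open import Data.Vec.Properties using (≡-dec)
import Data.Fin as Fin
import Data.Bool as Bool
open import Data.List using (List; []; _∷_; map; concatMap; upTo; allFin; filterᵇ; length; foldr)
open import Data.Bool.ListAction using (any; all)
open import Relation.Nullary using (does)
open import Algebra.Bundles using (CommutativeSemiring)

-- Permutations of {0,...,N-1} (i.e. of {1,...,N}) in one-line notation: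
-- w is the map x ↦ lookup w x.

Perm : ℕ → Set
Perm N = Vec (Fin N) N

one : ∀ {N} → Perm N
one = tabulate (λ x → x)

_·_ : ∀ {N} → Perm N → Perm N → Perm N
u · v = tabulate (λ x → lookup u (lookup v x))

_==_ : ∀ {N} → Perm N → Perm N → Bool
u == v = does (≡-dec Fin._≟_ u v)

-- sw i : the transposition s_i = (i, i+1) (1-based), i.e. swapping the
-- 0-based points i-1 and i.  (Identity for out-of-range i; only used
-- for 1 ≤ i ≤ N-1.)
sw : ℕ → ∀ {N} → Fin N → Fin N
sw zero x = x
sw (suc zero) {suc (suc N)} zero = suc zero
sw (suc zero) {suc (suc N)} (suc zero) = zero
sw (suc zero) {suc (suc N)} (suc (suc x)) = suc (suc x)
sw (suc zero) {suc zero} x = x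
sw (suc (suc i)) zero = zero
sw (suc (suc i)) (suc x) = suc (sw (suc i) x)

s : ∀ {N} → ℕ → Perm N
s i = tabulate (sw i)

a : ∀ {N} → ℕ → Perm N
a i = s 1 · s (suc i)

a1⁻¹ : ∀ {N} → Perm N
a1⁻¹ = s 2 · s 1

-- Coset representatives.
-- rS j k = s_j s_{j-1} ⋯ s_{j-k+1}   (0 ≤ k ≤ j); R^S_j = { rS j k | k ≤ j }
rS : ∀ {N} → ℕ → ℕ → Perm N
rS j zero = one
rS j (suc k) = rS j k · s (j ∸ k)

-- rA j k = a_j a_{j-1} ⋯ a_{j-k+1}   (0 ≤ k ≤ j),
-- rA j (j+1) = a_j ⋯ a_2 a_1^{-1};   R^A_j = { rA j k | k ≤ j+1 }
aprod : ∀ {N} → ℕ → ℕ → Perm N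
aprod j zero = one
aprod j (suc k) = aprod j k · a (j ∸ k)

rA : ∀ {N} → ℕ → ℕ → Perm N
rA j k = if suc j ≡ᵇ k then aprod j (j ∸ 1) · a1⁻¹ else aprod j k

-- A choice of factors w_1 ⋯ w_m is a vector (k_1,...,k_m) of indices,
-- k_j selecting the k_j-th listed element of R_j.
-- tuples b m : all (k_1,...,k_m) with k_j < b j.
tuples : (ℕ → ℕ) → (m : ℕ) → List (Vec ℕ m)
tuples b zero = [] ∷ []
tuples b (suc m) = concatMap (λ ks → map (λ k → ks ∷ʳ k) (upTo (b (suc m)))) (tuples b m)

prodF : ∀ {N m} → (ℕ → ℕ → Perm N) → ℕ → Vec ℕ m → Perm N
prodF r j [] = one
prodF r j (k ∷ ks) = r j k · prodF r (suc j) ks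

-- ε-patterns: S: ε_j = 1 iff w_j = s_j ⋯ s_1 (k_j = j);
--             A: ε_j = 1 iff a_1^{±1} occurs in w_j (k_j ∈ {j, j+1}).
patS : ∀ {m} → ℕ → Vec ℕ m → Vec Bool m
patS j [] = []
patS j (k ∷ ks) = (k ≡ᵇ j) ∷ patS (suc j) ks

patA : ∀ {m} → ℕ → Vec ℕ m → Vec Bool m
patA j [] = []
patA j (k ∷ ks) = (j ≤ᵇ k) ∷ patA (suc j) ks

_==B_ : ∀ {m} → Vec Bool m → Vec Bool m → Bool
u ==B v = does (≡-dec Bool._≟_ u v)

allVecs : ∀ {A : Set} → List A → (m : ℕ) → List (Vec A m)
allVecs xs zero = [] ∷ []
allVecs xs (suc m) = concatMap (λ v → map (λ x → x ∷ v) xs) (allVecs xs m)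

isPerm : ∀ {N} → Perm N → Bool
isPerm {N} w = all (λ y → any (λ x → does (y Fin.≟ lookup w x)) (allFin N)) (allFin N)

inv : ∀ {N} → Perm N → ℕ
inv {N} w = length (filterᵇ (λ p → does (p Data.Nat.≟ 1))
  (concatMap (λ i → map (λ j → if does (i <? j) ∧ does (lookup w j <? lookup w i) then 1 else 0) (allFin N)) (allFin N)))

isEven : ∀ {N} → Perm N → Bool
isEven w = inv w % 2 ≡ᵇ 0

Sym : (N : ℕ) → List (Perm N)
Sym N = filterᵇ isPerm (allVecs (allFin N) N)

Alt : (N : ℕ) → List (Perm N)
Alt N = filterᵇ isEven (Sym N)

-- ε_S(w) = ε  (w ∈ S_n, n = m+1): the (unique) factorization w = w_1⋯w_m,
-- w_j ∈ R^S_j, has pattern ε.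
hasεS : (m : ℕ) → Perm (suc m) → Vec Bool m → Bool
hasεS m w ε = any (λ ks → (prodF rS 1 ks == w) ∧ (patS 1 ks ==B ε)) (tuples suc m)

-- ε_A(v) = ε  (v ∈ A_{n+1}, n = m+1), factors v_j ∈ R^A_j (j+2 choices)
hasεA : (m : ℕ) → Perm (suc (suc m)) → Vec Bool m → Bool
hasεA m v ε = any (λ ks → (prodF rA 1 ks == v) ∧ (patA 1 ks ==B ε)) (tuples (λ j → suc (suc j)) m)

wS : (n : ℕ) → Vec Bool (n ∸ 1) → ℕ
wS zero ε = 0
wS (suc m) ε = length (filterᵇ (λ w → hasεS m w ε) (Sym (suc m)))

wA : (n : ℕ) → Vec Bool (n ∸ 1) → ℕ
wA zero ε = 0
wA (suc m) ε = length (filterᵇ (λ v → hasεA m v ε) (Alt (suc (suc m))))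

module GF {c ℓ : Level} (R : CommutativeSemiring c ℓ) where
  open CommutativeSemiring R

  ι : ℕ → Carrier
  ι zero = 0#
  ι (suc k) = 1# + ι k

  mono : ∀ {m} → Vec Carrier m → Vec Bool m → Carrier
  mono [] [] = 1#
  mono (t ∷ ts) (e ∷ es) = (if e then t else 1#) * mono ts es

  genFun : (n : ℕ) → (Vec Bool (n ∸ 1) → ℕ) → Vec Carrier (n ∸ 1) → Carrier
  genFun n w t = foldr _+_ 0# (map (λ ε → ι (w ε) * mono t ε) (allVecs (true ∷ false ∷ []) (n ∸ 1)))

  prodS : ∀ {m} → ℕ → Vec Carrier m → Carrier
  prodS j [] = 1#
  prodS j (t ∷ ts) = (t + ι j) * prodS (suc j) ts

  prodA : ∀ {m} → ℕ → Vec Carrier m → Carrier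
  prodA j [] = 1#
  prodA j (t ∷ ts) = ((t + t) + ι j) * prodA (suc j) ts

-- Every w ∈ S_n factors uniquely as w_1 ⋯ w_{n-1} with w_j ∈ R^S_j, and every v ∈ A_{n+1} as
-- v_1 ⋯ v_{n-1} with v_j ∈ R^A_j. Uniqueness: w_j fixes every point above j (resp. j + 1) and sends a
-- point determined by w_j to that top point, so the last factor is read off from the preimage of the
-- top point and can be cancelled. The products of the a_i are even, each a_i being a product of two
-- adjacent transpositions, and each of these changes the number of inversions by one. Hence w_S(n, ε)
-- is the number of index tuples (k_1, …, k_{n-1}), k_j ≤ j, with ε_j = 1 exactly when k_j = j, that is
-- ∏_j (1 if ε_j = 1, j otherwise); for A_{n+1} the choices are k_j ≤ j + 1 and ε_j = 1 for two of
-- them. Summing over ε, each factor contributes t_j + j, resp. 2 t_j + j.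
module Submission where

open import Defs
open import Level using (Level)
open import Algebra.Bundles using (CommutativeSemiring)
open import Data.Bool using (Bool; true; false; if_then_else_)
open import Data.Nat using (ℕ; zero; suc)
import Data.Nat as ℕ
open import Data.List using (List; []; _∷_; map; concatMap; foldr; _++_)
open import Data.Vec using (Vec; []; _∷_)
open import Relation.Binary.PropositionalEquality using (_≡_; cong)

weightProd : (ℕ → Bool → ℕ) → ∀ {m} → ℕ → Vec Bool m → ℕ
weightProd wt j [] = 1
weightProd wt j (e ∷ es) = wt j e ℕ.* weightProd wt (suc j) es

module Expansion {c ℓ : Level} (R : CommutativeSemiring c ℓ) where
  open CommutativeSemiring R
  open GF R
  open import Relation.Binary.Reasoning.Setoid setoid
  open import Algebra.Solver.Ring.NaturalCoefficients.Default R

  ι-+ : ∀ m n → ι (m ℕ.+ n) ≈ ι m + ι n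
  ι-+ zero n = sym (+-identityˡ (ι n))
  ι-+ (suc m) n = trans (+-congˡ (ι-+ m n)) (sym (+-assoc 1# (ι m) (ι n)))

  ι-* : ∀ m n → ι (m ℕ.* n) ≈ ι m * ι n
  ι-* zero n = sym (zeroˡ (ι n))
  ι-* (suc m) n = begin
    ι (n ℕ.+ m ℕ.* n)           ≈⟨ ι-+ n (m ℕ.* n) ⟩
    ι n + ι (m ℕ.* n)         ≈⟨ +-congˡ (ι-* m n) ⟩
    ι n + ι m * ι n         ≈⟨ +-congʳ (*-identityˡ (ι n)) ⟨
    1# * ι n + ι m * ι n    ≈⟨ distribʳ (ι n) 1# (ι m) ⟨
    (1# + ι m) * ι n        ∎

  ∑ : ∀ {A : Set} → (A → Carrier) → List A → Carrier
  ∑ f xs = foldr _+_ 0# (map f xs)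

  ∑-++ : ∀ {A : Set} (f : A → Carrier) (xs ys : List A) → ∑ f (xs ++ ys) ≈ ∑ f xs + ∑ f ys
  ∑-++ f [] ys = sym (+-identityˡ _)
  ∑-++ f (x ∷ xs) ys = trans (+-congˡ (∑-++ f xs ys)) (sym (+-assoc _ _ _))

  ∑-concatMap : ∀ {A B : Set} (f : B → Carrier) (g : A → List B) (xs : List A) → ∑ f (concatMap g xs) ≈ ∑ (λ x → ∑ f (g x)) xs
  ∑-concatMap f g [] = refl
  ∑-concatMap f g (x ∷ xs) = trans (∑-++ f (g x) (concatMap g xs)) (+-congˡ (∑-concatMap f g xs))

  ∑-cong : ∀ {A : Set} {f g : A → Carrier} → (∀ x → f x ≈ g x) → (xs : List A) → ∑ f xs ≈ ∑ g xs
  ∑-cong f≈g [] = refl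
  ∑-cong f≈g (x ∷ xs) = +-cong (f≈g x) (∑-cong f≈g xs)

  *-distribˡ-∑ : ∀ {A : Set} (k : Carrier) (f : A → Carrier) (xs : List A) → ∑ (λ x → k * f x) xs ≈ k * ∑ f xs
  *-distribˡ-∑ k f [] = sym (zeroʳ k)
  *-distribˡ-∑ k f (x ∷ xs) = trans (+-congˡ (*-distribˡ-∑ k f xs)) (sym (distribˡ k _ _))

  linearProd : (ℕ → Bool → ℕ) → ∀ {m} → ℕ → Vec Carrier m → Carrier
  linearProd wt j [] = 1#
  linearProd wt j (t ∷ ts) = (ι (wt j true) * t + ι (wt j false)) * linearProd wt (suc j) ts

  ∑-weightProd-mono : ∀ wt m j (ts : Vec Carrier m)
    → ∑ (λ ε → ι (weightProd wt j ε) * mono ts ε) (allVecs (true ∷ false ∷ []) m) ≈ linearProd wt j ts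
  ∑-weightProd-mono wt zero j [] = trans (+-identityʳ _) (trans (*-identityʳ _) (+-identityʳ 1#))
  ∑-weightProd-mono wt (suc m) j (t ∷ ts) = begin
    ∑ F (concatMap (λ v → map (_∷ v) bits) (allVecs bits m))  ≈⟨ ∑-concatMap F (λ v → map (_∷ v) bits) (allVecs bits m) ⟩
    ∑ (λ v → F (true ∷ v) + (F (false ∷ v) + 0#)) (allVecs bits m) ≈⟨ ∑-cong first-factor (allVecs bits m) ⟩
    ∑ (λ v → K * G v) (allVecs bits m)                         ≈⟨ *-distribˡ-∑ K G (allVecs bits m) ⟩
    K * ∑ G (allVecs bits m)                                   ≈⟨ *-congˡ (∑-weightProd-mono wt m (suc j) ts) ⟩
    K * linearProd wt (suc j) ts                               ∎
    where
    bits : List Bool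
    bits = true ∷ false ∷ []
    F : Vec Bool (suc m) → Carrier
    F ε = ι (weightProd wt j ε) * mono (t ∷ ts) ε
    G : Vec Bool m → Carrier
    G v = ι (weightProd wt (suc j) v) * mono ts v
    K : Carrier
    K = ι (wt j true) * t + ι (wt j false)
    first-factor : ∀ v → F (true ∷ v) + (F (false ∷ v) + 0#) ≈ K * G v
    first-factor v = begin
      ι (wt j true ℕ.* W) * (t * M) + (ι (wt j false ℕ.* W) * (1# * M) + 0#)
        ≈⟨ +-cong (*-congʳ (ι-* (wt j true) W)) (+-congʳ (*-congʳ (ι-* (wt j false) W))) ⟩
      ι (wt j true) * ι W * (t * M) + (ι (wt j false) * ι W * (1# * M) + 0#)
        ≈⟨ solve 5 (λ a b w t m → a :* w :* (t :* m) :+ (b :* w :* (con 1 :* m) :+ con 0) := (a :* t :+ b) :* (w :* m))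
                   refl (ι (wt j true)) (ι (wt j false)) (ι W) t M ⟩
      K * G v
        ∎
      where
      W = weightProd wt (suc j) v
      M = mono ts v

  genFun-linearProd : ∀ m (w : Vec Bool m → ℕ) wt → (∀ ε → w ε ≡ weightProd wt 1 ε)
    → (ts : Vec Carrier m) → genFun (suc m) w ts ≈ linearProd wt 1 ts
  genFun-linearProd m w wt w≡ ts = begin
    genFun (suc m) w ts                                  ≈⟨ ∑-cong (λ ε → reflexive (cong (λ k → ι k * mono ts ε) (w≡ ε))) vecs ⟩
    ∑ (λ ε → ι (weightProd wt 1 ε) * mono ts ε) vecs     ≈⟨ ∑-weightProd-mono wt m 1 ts ⟩
    linearProd wt 1 ts                                   ∎
    where
    vecs = allVecs (true ∷ false ∷ []) m

  linearProd-prodS : ∀ wt → (∀ j e → wt j e ≡ (if e then 1 else j)) → ∀ {m} j (ts : Vec Carrier m) → linearProd wt j ts ≈ prodS j ts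
  linearProd-prodS wt wt≡ j [] = refl
  linearProd-prodS wt wt≡ j (t ∷ ts) rewrite wt≡ j true | wt≡ j false =
    *-cong (+-congʳ (trans (*-congʳ (+-identityʳ 1#)) (*-identityˡ t))) (linearProd-prodS wt wt≡ (suc j) ts)

  linearProd-prodA : ∀ wt → (∀ j e → wt j e ≡ (if e then 2 else j)) → ∀ {m} j (ts : Vec Carrier m) → linearProd wt j ts ≈ prodA j ts
  linearProd-prodA wt wt≡ j [] = refl
  linearProd-prodA wt wt≡ j (t ∷ ts) rewrite wt≡ j true | wt≡ j false =
    *-cong (+-congʳ (solve 1 (λ t → (con 1 :+ (con 1 :+ con 0)) :* t := t :+ t) refl t)) (linearProd-prodA wt wt≡ (suc j) ts)

  genFun-prodS : ∀ m (w : Vec Bool m → ℕ) wt → (∀ ε → w ε ≡ weightProd wt 1 ε) → (∀ j e → wt j e ≡ (if e then 1 else j))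
    → (ts : Vec Carrier m) → genFun (suc m) w ts ≈ prodS 1 ts
  genFun-prodS m w wt w≡ wt≡ ts = trans (genFun-linearProd m w wt w≡ ts) (linearProd-prodS wt wt≡ 1 ts)

  genFun-prodA : ∀ m (w : Vec Bool m → ℕ) wt → (∀ ε → w ε ≡ weightProd wt 1 ε) → (∀ j e → wt j e ≡ (if e then 2 else j))
    → (ts : Vec Carrier m) → genFun (suc m) w ts ≈ prodA 1 ts
  genFun-prodA m w wt w≡ wt≡ ts = trans (genFun-linearProd m w wt w≡ ts) (linearProd-prodA wt wt≡ 1 ts)

open import Data.Bool using (Bool; true; false; _∧_; not; T; T?; if_then_else_)
import Data.Bool as Bool
open import Data.Bool.ListAction using (any)
open import Data.Bool.Properties using (not-involutive; T-≡; T-∧; ∧-assoc; ∧-identityʳ)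
open import Data.Fin as Fin using (Fin; zero; suc; toℕ; fromℕ<)
open import Data.Fin.Properties using (toℕ-injective; toℕ-fromℕ<; toℕ<n)
open import Data.List using (List; []; _∷_; map; concatMap; cartesianProductWith; upTo; filterᵇ; length; allFin; _++_)
import Data.List as List
open import Data.List.Membership.Propositional using (_∈_; find; lose)
open import Data.List.Membership.Propositional.Properties
  using (∈-cartesianProductWith⁺; ∈-cartesianProductWith⁻; ∈-upTo⁻; ∈-allFin; ∈-filter⁺; ∈-filter⁻; ∈-map⁺; ∈-map⁻)
open import Data.List.Membership.Propositional.Properties.WithK using (unique∧set⇒bag)
open import Data.List.Properties using (filter-++; length-++; length-map; map-tabulate; upTo-∷ʳ)
open import Data.List.Relation.Binary.BagAndSetEquality using (∼bag⇒↭)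
open import Data.List.Relation.Binary.Permutation.Propositional.Properties using (↭-length)
import Data.List.Relation.Unary.All as All
open import Data.List.Relation.Unary.All.Properties using (all⁻)
import Data.List.Relation.Unary.AllPairs as AllPairs
open import Data.List.Relation.Unary.Any using (here; there)
open import Data.List.Relation.Unary.Any.Properties using (any⁺; any⁻)
open import Data.List.Relation.Unary.Unique.Propositional using (Unique)
import Data.List.Relation.Unary.Unique.Propositional.Properties as Unique
open import Data.Nat using (ℕ; zero; suc; _+_; _*_; _∸_; _%_; _<_; _≤_; _<ᵇ_; _≡ᵇ_; _≤ᵇ_; z≤n; s≤s; s<s)
open import Data.Nat.Properties
open import Algebra.Properties.CommutativeMonoid.Sum +-0-commutativeMonoid
  using (sum-syntax; ∑-distrib-+; sum-cong-≗; sum-replicate-zero)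
open import Data.Product using (∃₂; _×_; _,_; proj₁; proj₂; swap)
open import Data.Sum using (inj₁; inj₂)
open import Data.Vec using (Vec; []; _∷_; _∷ʳ_; lookup; initLast)
open import Data.Vec.Properties using (lookup∘tabulate; tabulate∘lookup; tabulate-cong; ≡-dec; ∷ʳ-injective; ∷-injective)
open import Function using (_∘_)
open import Function.Bundles using (mk⇔; Equivalence)
open import Relation.Binary.Definitions using (DecidableEquality)
open import Relation.Binary.PropositionalEquality
open import Relation.Nullary using (does; contradiction)
open import Relation.Nullary.Decidable using (dec-true; dec-false; toWitness; fromWitness; isYes≗does)

module _ {N : ℕ} where

  lookup-· : (u v : Perm N) (x : Fin N) → lookup (u · v) x ≡ lookup u (lookup v x)
  lookup-· u v = lookup∘tabulate _

  lookup-one : (x : Fin N) → lookup (one {N}) x ≡ x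
  lookup-one = lookup∘tabulate _

  lookup-s : (i : ℕ) (x : Fin N) → lookup (s {N} i) x ≡ sw i x
  lookup-s i = lookup∘tabulate _

  Perm-ext : {u v : Perm N} → (∀ x → lookup u x ≡ lookup v x) → u ≡ v
  Perm-ext {u} {v} u≗v = trans (sym (tabulate∘lookup u)) (trans (tabulate-cong u≗v) (tabulate∘lookup v))

  ·-assoc : (u v w : Perm N) → (u · v) · w ≡ u · (v · w)
  ·-assoc u v w = Perm-ext λ x → begin
    lookup ((u · v) · w) x       ≡⟨ lookup-· (u · v) w x ⟩
    lookup (u · v) (lookup w x)   ≡⟨ lookup-· u v _ ⟩
    lookup u (lookup v (lookup w x)) ≡⟨ cong (lookup u) (lookup-· v w x) ⟨
    lookup u (lookup (v · w) x)   ≡⟨ lookup-· u (v · w) x ⟨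
    lookup (u · (v · w)) x        ∎
    where open ≡-Reasoning

  ·-identityˡ : (u : Perm N) → one · u ≡ u
  ·-identityˡ u = Perm-ext λ x → trans (lookup-· one u x) (lookup-one _)

  ·-identityʳ : (u : Perm N) → u · one ≡ u
  ·-identityʳ u = Perm-ext λ x → trans (lookup-· u one x) (cong (lookup u) (lookup-one x))

  record Invertible (w : Perm N) : Set where
    constructor mkInvertible
    field
      inverse  : Perm N
      inverseˡ : ∀ x → lookup inverse (lookup w x) ≡ x
      inverseʳ : ∀ x → lookup w (lookup inverse x) ≡ x

  invertible-one : Invertible one
  invertible-one = mkInvertible one (λ x → trans (lookup-one _) (lookup-one x)) (λ x → trans (lookup-one _) (lookup-one x))

  invertible-· : {u v : Perm N} → Invertible u → Invertible v → Invertible (u · v)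
  invertible-· {u} {v} (mkInvertible u′ u′u uu′) (mkInvertible v′ v′v vv′) = mkInvertible (v′ · u′) left right
    where
    left : ∀ x → lookup (v′ · u′) (lookup (u · v) x) ≡ x
    left x rewrite lookup-· v′ u′ (lookup (u · v) x) | lookup-· u v x | u′u (lookup v x) = v′v x
    right : ∀ x → lookup (u · v) (lookup (v′ · u′) x) ≡ x
    right x rewrite lookup-· u v (lookup (v′ · u′) x) | lookup-· v′ u′ x | vv′ (lookup u′ x) = uu′ x

  invertible⇒injective : {w : Perm N} → Invertible w → ∀ {x y} → lookup w x ≡ lookup w y → x ≡ y
  invertible⇒injective (mkInvertible w′ w′w _) {x} {y} wx≡wy = trans (sym (w′w x)) (trans (cong (lookup w′) wx≡wy) (w′w y))

  ·-cancelʳ : {u v w : Perm N} → Invertible w → u · w ≡ v · w → u ≡ v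
  ·-cancelʳ {u} {v} {w} (mkInvertible w′ _ ww′) uw≡vw = Perm-ext λ y → begin
    lookup u y                              ≡⟨ cong (lookup u) (ww′ y) ⟨
    lookup u (lookup w (lookup w′ y))       ≡⟨ lookup-· u w _ ⟨
    lookup (u · w) (lookup w′ y)            ≡⟨ cong (λ z → lookup z (lookup w′ y)) uw≡vw ⟩
    lookup (v · w) (lookup w′ y)            ≡⟨ lookup-· v w _ ⟩
    lookup v (lookup w (lookup w′ y))       ≡⟨ cong (lookup v) (ww′ y) ⟩
    lookup v y                              ∎
    where open ≡-Reasoning

sw-involutive : ∀ i {N} (x : Fin N) → sw i (sw i x) ≡ x
sw-involutive zero x = refl
sw-involutive (suc zero) {suc (suc N)} zero = refl
sw-involutive (suc zero) {suc (suc N)} (suc zero) = refl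
sw-involutive (suc zero) {suc (suc N)} (suc (suc x)) = refl
sw-involutive (suc zero) {suc zero} x = refl
sw-involutive (suc (suc i)) zero = refl
sw-involutive (suc (suc i)) (suc x) = cong suc (sw-involutive (suc i) x)

sw-fixes-above : ∀ i {N} (x : Fin N) → i < toℕ x → sw i x ≡ x
sw-fixes-above zero x _ = refl
sw-fixes-above (suc zero) {suc (suc N)} (suc (suc x)) _ = refl
sw-fixes-above (suc zero) {suc (suc N)} (suc zero) (s<s ())
sw-fixes-above (suc zero) {suc zero} x _ = refl
sw-fixes-above (suc (suc i)) (suc x) (s<s i<x) = cong suc (sw-fixes-above (suc i) x i<x)

transposeℕ : ℕ → ℕ → ℕ
transposeℕ zero zero = 1
transposeℕ zero (suc zero) = 0
transposeℕ zero (suc (suc x)) = suc (suc x)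
transposeℕ (suc p) zero = zero
transposeℕ (suc p) (suc x) = suc (transposeℕ p x)

toℕ-sw : ∀ p {N} (x : Fin N) → suc p < N → toℕ (sw (suc p) x) ≡ transposeℕ p (toℕ x)
toℕ-sw zero {suc (suc N)} zero _ = refl
toℕ-sw zero {suc (suc N)} (suc zero) _ = refl
toℕ-sw zero {suc (suc N)} (suc (suc x)) _ = refl
toℕ-sw zero {suc zero} zero (s<s ())
toℕ-sw (suc p) zero _ = refl
toℕ-sw (suc p) {suc N} (suc x) (s<s p<N) = cong suc (toℕ-sw p x p<N)

transposeℕ-self : ∀ p → transposeℕ p p ≡ suc p
transposeℕ-self zero = refl
transposeℕ-self (suc p) = cong suc (transposeℕ-self p)

sw-moves-up : ∀ p {N} (x : Fin N) → suc p < N → toℕ x ≡ p → toℕ (sw (suc p) x) ≡ suc p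
sw-moves-up p x p<N refl = trans (toℕ-sw p x p<N) (transposeℕ-self (toℕ x))

module _ {N : ℕ} where

  invertible-s : (i : ℕ) → Invertible (s {N} i)
  invertible-s i = mkInvertible (s i) s∘s s∘s
    where
    s∘s : ∀ x → lookup (s i) (lookup (s i) x) ≡ x
    s∘s x rewrite lookup-s {N} i x | lookup-s {N} i (sw i x) = sw-involutive i x

concatMap-map≡cartesianProductWith : ∀ {A B C : Set} (f : A → B → C) (xs : List A) (ys : List B)
  → concatMap (λ x → map (f x) ys) xs ≡ cartesianProductWith f xs ys
concatMap-map≡cartesianProductWith f [] ys = refl
concatMap-map≡cartesianProductWith f (x ∷ xs) ys = cong (map (f x) ys ++_) (concatMap-map≡cartesianProductWith f xs ys)

tuples-suc : ∀ b m → tuples b (suc m) ≡ cartesianProductWith _∷ʳ_ (tuples b m) (upTo (b (suc m)))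
tuples-suc b m = concatMap-map≡cartesianProductWith _∷ʳ_ (tuples b m) (upTo (b (suc m)))

∈-tuples-suc⁻ : ∀ b m {ks} → ks ∈ tuples b (suc m) → ∃₂ λ ys y → ys ∈ tuples b m × y < b (suc m) × ks ≡ ys ∷ʳ y
∈-tuples-suc⁻ b m ks∈ with ∈-cartesianProductWith⁻ _∷ʳ_ (tuples b m) _ (subst (_ ∈_) (tuples-suc b m) ks∈)
... | ys , y , ys∈ , y∈ , ks≡ = ys , y , ys∈ , ∈-upTo⁻ y∈ , ks≡

tuples-unique : ∀ b m → Unique (tuples b m)
tuples-unique b zero = All.[] AllPairs.∷ AllPairs.[]
tuples-unique b (suc m) = subst Unique (sym (tuples-suc b m))
  (Unique.cartesianProductWith⁺ _∷ʳ_ (∷ʳ-injective _ _) (tuples-unique b m) (Unique.upTo⁺ _))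

module _ {N : ℕ} (r : ℕ → ℕ → Perm N) where

  prodF-∷ʳ : ∀ {m} j (ks : Vec ℕ m) k → prodF r j (ks ∷ʳ k) ≡ prodF r j ks · r (j + m) k
  prodF-∷ʳ j [] k = begin
    r j k · one         ≡⟨ ·-identityʳ (r j k) ⟩
    r j k               ≡⟨ cong (λ i → r i k) (+-identityʳ j) ⟨
    r (j + 0) k         ≡⟨ ·-identityˡ _ ⟨
    one · r (j + 0) k   ∎
    where open ≡-Reasoning
  prodF-∷ʳ {suc m} j (k₀ ∷ ks) k = begin
    r j k₀ · prodF r (suc j) (ks ∷ʳ k)              ≡⟨ cong (r j k₀ ·_) (prodF-∷ʳ (suc j) ks k) ⟩
    r j k₀ · (prodF r (suc j) ks · r (suc j + m) k)  ≡⟨ ·-assoc (r j k₀) (prodF r (suc j) ks) (r (suc j + m) k) ⟨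
    prodF r j (k₀ ∷ ks) · r (suc (j + m)) k          ≡⟨ cong (λ i → prodF r j (k₀ ∷ ks) · r i k) (+-suc j m) ⟨
    prodF r j (k₀ ∷ ks) · r (j + suc m) k            ∎
    where open ≡-Reasoning

  invertible-prodF : (∀ j k → Invertible (r j k)) → ∀ {m} j (ks : Vec ℕ m) → Invertible (prodF r j ks)
  invertible-prodF inv-r j [] = invertible-one
  invertible-prodF inv-r j (k ∷ ks) = invertible-· (inv-r j k) (invertible-prodF inv-r (suc j) ks)

-- If the j-th factor fixes every point above the level c + j and sends a point src j k, which
-- determines k, to that level, then the last factor of a product is read off from the preimage
-- of the top level, and by cancelling it the whole factorisation is unique.
module FactorisationInjective {N : ℕ} (r : ℕ → ℕ → Perm N) (b : ℕ → ℕ) (c : ℕ) (src : ℕ → ℕ → ℕ)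
  (r-invertible : ∀ j k → Invertible (r j k))
  (r-fixes-above : ∀ j k x → k < b (suc j) → c + suc j < toℕ x → lookup (r (suc j) k) x ≡ x)
  (r-moves-src : ∀ j k x → k < b (suc j) → c + suc j < N → toℕ x ≡ src (suc j) k
                 → toℕ (lookup (r (suc j) k) x) ≡ c + suc j)
  (src-bounded : ∀ j k → k < b (suc j) → src (suc j) k ≤ c + suc j)
  (src-injective : ∀ j {k k′} → k < b (suc j) → k′ < b (suc j) → src (suc j) k ≡ src (suc j) k′ → k ≡ k′)
  where

  lookup-prodF-∷ʳ : ∀ {m} (ys : Vec ℕ m) y x
    → lookup (prodF r 1 (ys ∷ʳ y)) x ≡ lookup (prodF r 1 ys) (lookup (r (suc m) y) x)
  lookup-prodF-∷ʳ {m} ys y x = trans (cong (λ w → lookup w x) (prodF-∷ʳ r 1 ys y)) (lookup-· (prodF r 1 ys) (r (suc m) y) x)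

  prodF-fixes-above : ∀ m {ks} x → ks ∈ tuples b m → c + m < toℕ x → lookup (prodF r 1 ks) x ≡ x
  prodF-fixes-above zero {[]} x _ _ = lookup-one x
  prodF-fixes-above (suc m) x ks∈ c+m<x with ∈-tuples-suc⁻ b m ks∈
  ... | ys , y , ys∈ , y< , refl = begin
    lookup (prodF r 1 (ys ∷ʳ y)) x                 ≡⟨ lookup-prodF-∷ʳ ys y x ⟩
    lookup (prodF r 1 ys) (lookup (r (suc m) y) x) ≡⟨ cong (lookup (prodF r 1 ys)) (r-fixes-above m y x y< c+m<x) ⟩
    lookup (prodF r 1 ys) x                        ≡⟨ prodF-fixes-above m x ys∈ (<-trans (+-monoʳ-< c (n<1+n m)) c+m<x) ⟩
    x                                              ∎
    where open ≡-Reasoning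

  src-point : ∀ m {y} → y < b (suc m) → c + suc m < N → Fin N
  src-point m y< top<N = fromℕ< (≤-<-trans (src-bounded m _ y<) top<N)

  prodF-src-point : ∀ m {ys y} → ys ∈ tuples b m → (y< : y < b (suc m)) (top<N : c + suc m < N)
    → toℕ (lookup (prodF r 1 (ys ∷ʳ y)) (src-point m y< top<N)) ≡ c + suc m
  prodF-src-point m {ys} {y} ys∈ y< top<N = begin
    toℕ (lookup (prodF r 1 (ys ∷ʳ y)) x)                  ≡⟨ cong toℕ (lookup-prodF-∷ʳ ys y x) ⟩
    toℕ (lookup (prodF r 1 ys) (lookup (r (suc m) y) x))  ≡⟨ cong toℕ (prodF-fixes-above m _ ys∈ above) ⟩
    toℕ (lookup (r (suc m) y) x)                          ≡⟨ hit ⟩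
    c + suc m                                             ∎
    where
    open ≡-Reasoning
    x = src-point m y< top<N
    hit : toℕ (lookup (r (suc m) y) x) ≡ c + suc m
    hit = r-moves-src m y x y< top<N (toℕ-fromℕ< _)
    above : c + m < toℕ (lookup (r (suc m) y) x)
    above = subst (c + m <_) (sym hit) (+-monoʳ-< c (n<1+n m))

  prodF-injective : ∀ m {ks ks′} → ks ∈ tuples b m → ks′ ∈ tuples b m → c + m < N
    → prodF r 1 ks ≡ prodF r 1 ks′ → ks ≡ ks′
  prodF-injective zero {[]} {[]} _ _ _ _ = refl
  prodF-injective (suc m) ks∈ ks′∈ top<N w≡w′ with ∈-tuples-suc⁻ b m ks∈ | ∈-tuples-suc⁻ b m ks′∈
  ... | ys , y , ys∈ , y< , refl | ys′ , y′ , ys′∈ , y′< , refl = cong₂ _∷ʳ_ ys≡ys′ y≡y′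
    where
    x x′ : Fin N
    x = src-point m y< top<N
    x′ = src-point m y′< top<N
    x≡x′ : x ≡ x′
    x≡x′ = invertible⇒injective (invertible-prodF r r-invertible 1 (ys′ ∷ʳ y′)) (trans
      (cong (λ w → lookup w x) (sym w≡w′))
      (toℕ-injective (trans (prodF-src-point m ys∈ y< top<N) (sym (prodF-src-point m ys′∈ y′< top<N)))))
    y≡y′ : y ≡ y′
    y≡y′ = src-injective m y< y′< (trans (sym (toℕ-fromℕ< _)) (trans (cong toℕ x≡x′) (toℕ-fromℕ< _)))
    last-factors : prodF r 1 ys · r (suc m) y ≡ prodF r 1 ys′ · r (suc m) y′
    last-factors = trans (sym (prodF-∷ʳ r 1 ys y)) (trans w≡w′ (prodF-∷ʳ r 1 ys′ y′))
    ys≡ys′ : ys ≡ ys′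
    ys≡ys′ = prodF-injective m ys∈ ys′∈ (<-trans (+-monoʳ-< c (n<1+n m)) top<N)
      (·-cancelʳ (r-invertible (suc m) y′) (subst (λ z → prodF r 1 ys · r (suc m) z ≡ _) y≡y′ last-factors))

m∸n≡1+[m∸1+n] : ∀ {m n} → n < m → m ∸ n ≡ suc (m ∸ suc n)
m∸n≡1+[m∸1+n] n<m = +-∸-assoc 1 n<m

module _ {N : ℕ} where

  rS-fixes-above : ∀ j k (x : Fin N) → j < toℕ x → lookup (rS {N} j k) x ≡ x
  rS-fixes-above j zero x _ = lookup-one x
  rS-fixes-above j (suc k) x j<x = begin
    lookup (rS j k · s (j ∸ k)) x         ≡⟨ lookup-· (rS j k) (s (j ∸ k)) x ⟩
    lookup (rS j k) (lookup (s (j ∸ k)) x) ≡⟨ cong (lookup (rS j k)) (lookup-s (j ∸ k) x) ⟩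
    lookup (rS j k) (sw (j ∸ k) x)         ≡⟨ cong (lookup (rS j k)) (sw-fixes-above (j ∸ k) x (≤-<-trans (m∸n≤m j k) j<x)) ⟩
    lookup (rS j k) x                      ≡⟨ rS-fixes-above j k x j<x ⟩
    x                                      ∎
    where open ≡-Reasoning

  rS-moves-src : ∀ j k (x : Fin N) → k ≤ j → j < N → toℕ x ≡ j ∸ k → toℕ (lookup (rS {N} j k) x) ≡ j
  rS-moves-src j zero x _ _ x≡j = trans (cong toℕ (lookup-one x)) x≡j
  rS-moves-src j (suc k) x k<j j<N x≡ = begin
    toℕ (lookup (rS j k · s (j ∸ k)) x)  ≡⟨ cong toℕ (lookup-· (rS j k) (s (j ∸ k)) x) ⟩
    toℕ (lookup (rS j k) (lookup (s (j ∸ k)) x)) ≡⟨ rS-moves-src j k _ (<⇒≤ k<j) j<N moved ⟩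
    j                                    ∎
    where
    open ≡-Reasoning
    moved : toℕ (lookup (s (j ∸ k)) x) ≡ j ∸ k
    moved rewrite lookup-s {N} (j ∸ k) x | m∸n≡1+[m∸1+n] k<j =
      sw-moves-up (j ∸ suc k) x (subst (_< N) (m∸n≡1+[m∸1+n] k<j) (≤-<-trans (m∸n≤m j k) j<N)) x≡

  invertible-rS : ∀ j k → Invertible (rS {N} j k)
  invertible-rS j zero = invertible-one
  invertible-rS j (suc k) = invertible-· (invertible-rS j k) (invertible-s (j ∸ k))

prodF-rS-injective : ∀ m {ks ks′} → ks ∈ tuples suc m → ks′ ∈ tuples suc m
  → prodF (rS {suc m}) 1 ks ≡ prodF rS 1 ks′ → ks ≡ ks′
prodF-rS-injective m ks∈ ks′∈ = prodF-injective m ks∈ ks′∈ ≤-refl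
  where
  open FactorisationInjective (rS {suc m}) suc 0 _∸_ invertible-rS
    (λ j k x _ → rS-fixes-above (suc j) k x)
    (λ j k x k< → rS-moves-src (suc j) k x (≤-pred k<))
    (λ j k _ → m∸n≤m (suc j) k)
    (λ j k< k′< → ∸-cancelˡ-≡ (≤-pred k<) (≤-pred k′<))

module _ {N : ℕ} where

  lookup-a : ∀ i (x : Fin N) → lookup (a {N} i) x ≡ sw 1 (sw (suc i) x)
  lookup-a i x = trans (lookup-· (s 1) (s (suc i)) x) (trans (lookup-s 1 _) (cong (sw 1) (lookup-s (suc i) x)))

  lookup-a1⁻¹ : (x : Fin N) → lookup (a1⁻¹ {N}) x ≡ sw 2 (sw 1 x)
  lookup-a1⁻¹ x = trans (lookup-· (s 2) (s 1) x) (trans (lookup-s 2 _) (cong (sw 2) (lookup-s 1 x)))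

  invertible-a : ∀ i → Invertible (a {N} i)
  invertible-a i = invertible-· (invertible-s 1) (invertible-s (suc i))

  invertible-a1⁻¹ : Invertible (a1⁻¹ {N})
  invertible-a1⁻¹ = invertible-· (invertible-s 2) (invertible-s 1)

  invertible-aprod : ∀ j k → Invertible (aprod {N} j k)
  invertible-aprod j zero = invertible-one
  invertible-aprod j (suc k) = invertible-· (invertible-aprod j k) (invertible-a (j ∸ k))

  aprod-fixes-above : ∀ j k (x : Fin N) → suc j < toℕ x → lookup (aprod {N} j k) x ≡ x
  aprod-fixes-above j zero x _ = lookup-one x
  aprod-fixes-above j (suc k) x sj<x = begin
    lookup (aprod j k · a (j ∸ k)) x           ≡⟨ lookup-· (aprod j k) (a (j ∸ k)) x ⟩
    lookup (aprod j k) (lookup (a (j ∸ k)) x)   ≡⟨ cong (lookup (aprod j k)) (lookup-a (j ∸ k) x) ⟩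
    lookup (aprod j k) (sw 1 (sw (suc (j ∸ k)) x))
      ≡⟨ cong (λ y → lookup (aprod j k) (sw 1 y)) (sw-fixes-above _ x (≤-<-trans (s≤s (m∸n≤m j k)) sj<x)) ⟩
    lookup (aprod j k) (sw 1 x)                 ≡⟨ cong (lookup (aprod j k)) (sw-fixes-above 1 x (≤-<-trans (s≤s z≤n) sj<x)) ⟩
    lookup (aprod j k) x                        ≡⟨ aprod-fixes-above j k x sj<x ⟩
    x                                           ∎
    where open ≡-Reasoning

  aprod-moves-src : ∀ j k (x : Fin N) → k ≤ j → suc j < N → toℕ x ≡ suc j ∸ k → toℕ (lookup (aprod {N} j k) x) ≡ suc j
  aprod-moves-src j zero x _ _ x≡ = trans (cong toℕ (lookup-one x)) x≡
  aprod-moves-src j (suc k) x k<j sj<N x≡ = begin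
    toℕ (lookup (aprod j k · a (j ∸ k)) x)         ≡⟨ cong toℕ (lookup-· (aprod j k) (a (j ∸ k)) x) ⟩
    toℕ (lookup (aprod j k) (lookup (a (j ∸ k)) x)) ≡⟨ aprod-moves-src j k _ (<⇒≤ k<j) sj<N moved ⟩
    suc j                                          ∎
    where
    open ≡-Reasoning
    up : toℕ (sw (suc (j ∸ k)) x) ≡ suc (j ∸ k)
    up = sw-moves-up (j ∸ k) x (≤-<-trans (s≤s (m∸n≤m j k)) sj<N) x≡
    1<up : 1 < toℕ (sw (suc (j ∸ k)) x)
    1<up rewrite up | m∸n≡1+[m∸1+n] k<j = s≤s (s≤s z≤n)
    moved : toℕ (lookup (a (j ∸ k)) x) ≡ suc j ∸ k
    moved = begin
      toℕ (lookup (a (j ∸ k)) x)         ≡⟨ cong toℕ (lookup-a (j ∸ k) x) ⟩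
      toℕ (sw 1 (sw (suc (j ∸ k)) x))    ≡⟨ cong toℕ (sw-fixes-above 1 _ 1<up) ⟩
      toℕ (sw (suc (j ∸ k)) x)           ≡⟨ up ⟩
      suc (j ∸ k)                        ≡⟨ +-∸-assoc 1 (<⇒≤ k<j) ⟨
      suc j ∸ k                          ∎

  rA-elim : ∀ (P : Perm N → Set) j k → P (aprod j k) → P (aprod j (j ∸ 1) · a1⁻¹) → P (rA j k)
  rA-elim P j k p q with suc j ≡ᵇ k
  ... | true = q
  ... | false = p

  rA-aprod : ∀ j k → k ≤ j → rA {N} j k ≡ aprod j k
  rA-aprod j k k≤j rewrite dec-false (suc j ≟ k) (λ sj≡k → <⇒≱ (s≤s ≤-refl) (subst (_≤ j) (sym sj≡k) k≤j)) = refl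

  rA-last : ∀ i → rA {N} (suc i) (suc (suc i)) ≡ aprod (suc i) i · a1⁻¹
  rA-last i rewrite dec-true (i ≟ i) refl = refl

  invertible-rA : ∀ j k → Invertible (rA {N} j k)
  invertible-rA j k = rA-elim Invertible j k (invertible-aprod j k) (invertible-· (invertible-aprod j (j ∸ 1)) invertible-a1⁻¹)

  rA-fixes-above : ∀ i k (x : Fin N) → suc (suc i) < toℕ x → lookup (rA {N} (suc i) k) x ≡ x
  rA-fixes-above i k x ssi<x = rA-elim (λ w → lookup w x ≡ x) (suc i) k (aprod-fixes-above (suc i) k x ssi<x) (begin
    lookup (aprod (suc i) i · a1⁻¹) x          ≡⟨ lookup-· (aprod (suc i) i) a1⁻¹ x ⟩
    lookup (aprod (suc i) i) (lookup a1⁻¹ x)   ≡⟨ cong (lookup (aprod (suc i) i)) (lookup-a1⁻¹ x) ⟩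
    lookup (aprod (suc i) i) (sw 2 (sw 1 x))
      ≡⟨ cong (λ y → lookup (aprod (suc i) i) (sw 2 y)) (sw-fixes-above 1 x (≤-<-trans (s≤s z≤n) ssi<x)) ⟩
    lookup (aprod (suc i) i) (sw 2 x)          ≡⟨ cong (lookup (aprod (suc i) i)) (sw-fixes-above 2 x (≤-<-trans (s≤s (s≤s z≤n)) ssi<x)) ⟩
    lookup (aprod (suc i) i) x                 ≡⟨ aprod-fixes-above (suc i) i x ssi<x ⟩
    x                                          ∎)
    where open ≡-Reasoning

  rA-moves-src : ∀ i k (x : Fin N) → k < suc (suc (suc i)) → suc (suc i) < N → toℕ x ≡ suc (suc i) ∸ k
    → toℕ (lookup (rA {N} (suc i) k) x) ≡ suc (suc i)
  rA-moves-src i k x k< ssi<N x≡ with m≤n⇒m<n∨m≡n (≤-pred k<)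
  ... | inj₁ k≤si rewrite rA-aprod (suc i) k (≤-pred k≤si) = aprod-moves-src (suc i) k x (≤-pred k≤si) ssi<N x≡
  ... | inj₂ refl rewrite rA-last i = begin
    toℕ (lookup (aprod (suc i) i · a1⁻¹) x)          ≡⟨ cong toℕ (lookup-· (aprod (suc i) i) a1⁻¹ x) ⟩
    toℕ (lookup (aprod (suc i) i) (lookup a1⁻¹ x))   ≡⟨ aprod-moves-src (suc i) i _ (n≤1+n i) ssi<N two ⟩
    suc (suc i)                                      ∎
    where
    open ≡-Reasoning
    x≡0 : toℕ x ≡ 0
    x≡0 = trans x≡ (n∸n≡0 (suc (suc i)))
    two : toℕ (lookup a1⁻¹ x) ≡ suc (suc i) ∸ i
    two = begin
      toℕ (lookup a1⁻¹ x)  ≡⟨ cong toℕ (lookup-a1⁻¹ x) ⟩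
      toℕ (sw 2 (sw 1 x))
        ≡⟨ sw-moves-up 1 (sw 1 x) (≤-<-trans (s≤s (s≤s z≤n)) ssi<N) (sw-moves-up 0 x (≤-<-trans (s≤s z≤n) ssi<N) x≡0) ⟩
      2                    ≡⟨ m+n∸n≡m 2 i ⟨
      suc (suc i) ∸ i      ∎

prodF-rA-injective : ∀ m {ks ks′} → ks ∈ tuples (λ j → suc (suc j)) m → ks′ ∈ tuples (λ j → suc (suc j)) m
  → prodF (rA {suc (suc m)}) 1 ks ≡ prodF rA 1 ks′ → ks ≡ ks′
prodF-rA-injective m ks∈ ks′∈ = prodF-injective m ks∈ ks′∈ ≤-refl
  where
  open FactorisationInjective (rA {suc (suc m)}) (λ j → suc (suc j)) 1 (λ j k → suc j ∸ k) invertible-rA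
    (λ j k x _ → rA-fixes-above j k x)
    (λ j k x k< → rA-moves-src j k x k<)
    (λ j k _ → m∸n≤m (suc (suc j)) k)
    (λ j k< k′< → ∸-cancelˡ-≡ (≤-pred k<) (≤-pred k′<))

𝟙 : Bool → ℕ
𝟙 true = 1
𝟙 false = 0

𝟙-∧ : ∀ x y → 𝟙 (x ∧ y) ≡ 𝟙 x * 𝟙 y
𝟙-∧ true y = sym (+-identityʳ (𝟙 y))
𝟙-∧ false y = refl

length-filterᵇ-++ : ∀ {A : Set} (p : A → Bool) (xs ys : List A)
  → length (filterᵇ p (xs ++ ys)) ≡ length (filterᵇ p xs) + length (filterᵇ p ys)
length-filterᵇ-++ p xs ys = trans (cong length (filter-++ _ xs ys)) (length-++ (filterᵇ p xs))

length-filterᵇ-tabulate : ∀ {A : Set} {N} (p : A → Bool) (h : Fin N → A)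
  → length (filterᵇ p (List.tabulate h)) ≡ ∑[ i < N ] 𝟙 (p (h i))
length-filterᵇ-tabulate {N = zero} p h = refl
length-filterᵇ-tabulate {N = suc N} p h with p (h zero)
... | true = cong suc (length-filterᵇ-tabulate p (h ∘ suc))
... | false = length-filterᵇ-tabulate p (h ∘ suc)

length-filterᵇ-concatMap-tabulate : ∀ {A B : Set} {N} (p : B → Bool) (g : A → List B) (h : Fin N → A)
  → length (filterᵇ p (concatMap g (List.tabulate h))) ≡ ∑[ i < N ] length (filterᵇ p (g (h i)))
length-filterᵇ-concatMap-tabulate {N = zero} p g h = refl
length-filterᵇ-concatMap-tabulate {N = suc N} p g h =
  trans (length-filterᵇ-++ p (g (h zero)) _) (cong (_ +_) (length-filterᵇ-concatMap-tabulate p g (h ∘ suc)))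

inversionSum : ∀ {N} → Perm N → ℕ
inversionSum {N} w = ∑[ i < N ] ∑[ j < N ] (𝟙 (toℕ i <ᵇ toℕ j) * 𝟙 (toℕ (lookup w j) <ᵇ toℕ (lookup w i)))

inv≡inversionSum : ∀ {N} (w : Perm N) → inv w ≡ inversionSum w
inv≡inversionSum {N} w = begin
  inv w
    ≡⟨ length-filterᵇ-concatMap-tabulate _ (λ i → map (entry i) (allFin N)) (λ i → i) ⟩
  ∑[ i < N ] length (filterᵇ (_≡ᵇ 1) (map (entry i) (allFin N)))
    ≡⟨ sum-cong-≗ (λ i → cong (length ∘ filterᵇ (_≡ᵇ 1)) (map-tabulate (λ j → j) (entry i))) ⟩
  ∑[ i < N ] length (filterᵇ (_≡ᵇ 1) (List.tabulate (entry i)))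
    ≡⟨ sum-cong-≗ (λ i → length-filterᵇ-tabulate (_≡ᵇ 1) (entry i)) ⟩
  ∑[ i < N ] ∑[ j < N ] 𝟙 (entry i j ≡ᵇ 1)
    ≡⟨ sum-cong-≗ (λ i → sum-cong-≗ (λ j → trans (entry-bit (inverted i j)) (𝟙-∧ (toℕ i <ᵇ toℕ j) _))) ⟩
  inversionSum w
    ∎
  where
  open ≡-Reasoning
  inverted : Fin N → Fin N → Bool
  inverted i j = (toℕ i <ᵇ toℕ j) ∧ (toℕ (lookup w j) <ᵇ toℕ (lookup w i))
  entry : Fin N → Fin N → ℕ
  entry i j = if inverted i j then 1 else 0
  entry-bit : ∀ b → 𝟙 ((if b then 1 else 0) ≡ᵇ 1) ≡ 𝟙 b
  entry-bit true = refl
  entry-bit false = refl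

∑-sw : ∀ i {N} (f : Fin N → ℕ) → ∑[ x < N ] f (sw i x) ≡ ∑[ x < N ] f x
∑-sw zero f = refl
∑-sw (suc zero) {zero} f = refl
∑-sw (suc zero) {suc zero} f = refl
∑-sw (suc zero) {suc (suc N)} f = begin
  f (suc zero) + (f zero + rest) ≡⟨ +-assoc (f (suc zero)) (f zero) rest ⟨
  f (suc zero) + f zero + rest   ≡⟨ cong (_+ rest) (+-comm (f (suc zero)) (f zero)) ⟩
  f zero + f (suc zero) + rest   ≡⟨ +-assoc (f zero) (f (suc zero)) rest ⟩
  f zero + (f (suc zero) + rest) ∎
  where
  open ≡-Reasoning
  rest = ∑[ x < N ] f (suc (suc x))
∑-sw (suc (suc i)) {zero} f = refl
∑-sw (suc (suc i)) {suc N} f = cong (f zero +_) (∑-sw (suc i) (f ∘ suc))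

∑-indicator : ∀ {N} (P : Fin N) (f : Fin N → ℕ) → ∑[ i < N ] (𝟙 (toℕ i ≡ᵇ toℕ P) * f i) ≡ f P
∑-indicator {suc N} zero f = begin
  f zero + 0 + ∑[ i < N ] 0 ≡⟨ cong (f zero + 0 +_) (sum-replicate-zero N) ⟩
  f zero + 0 + 0            ≡⟨ +-identityʳ _ ⟩
  f zero + 0                ≡⟨ +-identityʳ _ ⟩
  f zero                    ∎
  where open ≡-Reasoning
∑-indicator {suc N} (suc P) f = ∑-indicator P (f ∘ suc)

∑∑-indicator : ∀ {N} (P Q : Fin N) {p q} → toℕ P ≡ p → toℕ Q ≡ q → (f : Fin N → Fin N → ℕ)
  → ∑[ i < N ] ∑[ j < N ] (𝟙 (toℕ i ≡ᵇ p) * 𝟙 (toℕ j ≡ᵇ q) * f i j) ≡ f P Q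
∑∑-indicator {N} P Q refl refl f = begin
  ∑[ i < N ] ∑[ j < N ] (δP i * δQ j * f i j)   ≡⟨ sum-cong-≗ (λ i → sum-cong-≗ (λ j → reorder (δP i) (δQ j) (f i j))) ⟩
  ∑[ i < N ] ∑[ j < N ] (δQ j * (δP i * f i j)) ≡⟨ sum-cong-≗ (λ i → ∑-indicator Q (λ j → δP i * f i j)) ⟩
  ∑[ i < N ] (δP i * f i Q)                     ≡⟨ ∑-indicator P (λ i → f i Q) ⟩
  f P Q                                         ∎
  where
  open ≡-Reasoning
  δP δQ : Fin N → ℕ
  δP i = 𝟙 (toℕ i ≡ᵇ toℕ P)
  δQ j = 𝟙 (toℕ j ≡ᵇ toℕ Q)
  reorder : ∀ x y z → x * y * z ≡ y * (x * z)
  reorder x y z = trans (cong (_* z) (*-comm x y)) (*-assoc y x z)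

∑∑-distrib-+ : ∀ {N} (f g : Fin N → Fin N → ℕ)
  → ∑[ i < N ] ∑[ j < N ] (f i j + g i j) ≡ ∑[ i < N ] ∑[ j < N ] f i j + ∑[ i < N ] ∑[ j < N ] g i j
∑∑-distrib-+ {N} f g =
  trans (sum-cong-≗ (λ i → ∑-distrib-+ (f i) (g i))) (∑-distrib-+ {N} (λ i → ∑[ j < N ] f i j) (λ i → ∑[ j < N ] g i j))

-- The order of a pair changes under the transposition of p and suc p exactly for {p, suc p}.
transposeℕ-<ᵇ : ∀ p x y
  → 𝟙 (transposeℕ p x <ᵇ transposeℕ p y) + 𝟙 (x ≡ᵇ p) * 𝟙 (y ≡ᵇ suc p)
  ≡ 𝟙 (x <ᵇ y) + 𝟙 (x ≡ᵇ suc p) * 𝟙 (y ≡ᵇ p)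
transposeℕ-<ᵇ zero zero zero = refl
transposeℕ-<ᵇ zero zero (suc zero) = refl
transposeℕ-<ᵇ zero zero (suc (suc y)) = refl
transposeℕ-<ᵇ zero (suc zero) zero = refl
transposeℕ-<ᵇ zero (suc zero) (suc zero) = refl
transposeℕ-<ᵇ zero (suc zero) (suc (suc y)) = refl
transposeℕ-<ᵇ zero (suc (suc x)) zero = refl
transposeℕ-<ᵇ zero (suc (suc x)) (suc zero) = refl
transposeℕ-<ᵇ zero (suc (suc x)) (suc (suc y)) = refl
transposeℕ-<ᵇ (suc p) zero zero = refl
transposeℕ-<ᵇ (suc p) zero (suc y) = refl
transposeℕ-<ᵇ (suc p) (suc x) zero rewrite *-zeroʳ (𝟙 (x ≡ᵇ p)) | *-zeroʳ (𝟙 (x ≡ᵇ suc p)) = refl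
transposeℕ-<ᵇ (suc p) (suc x) (suc y) = transposeℕ-<ᵇ p x y

sw-<ᵇ : ∀ p {N} (i j : Fin N) → suc p < N
  → 𝟙 (toℕ (sw (suc p) i) <ᵇ toℕ (sw (suc p) j)) + 𝟙 (toℕ i ≡ᵇ p) * 𝟙 (toℕ j ≡ᵇ suc p)
  ≡ 𝟙 (toℕ i <ᵇ toℕ j) + 𝟙 (toℕ i ≡ᵇ suc p) * 𝟙 (toℕ j ≡ᵇ p)
sw-<ᵇ p i j sp<N rewrite toℕ-sw p i sp<N | toℕ-sw p j sp<N = transposeℕ-<ᵇ p (toℕ i) (toℕ j)

inversionSum-·-s-reindexed : ∀ {N} (w : Perm N) i
  → inversionSum (w · s i) ≡ ∑[ x < N ] ∑[ y < N ] (𝟙 (toℕ (sw i x) <ᵇ toℕ (sw i y)) * 𝟙 (toℕ (lookup w y) <ᵇ toℕ (lookup w x)))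
inversionSum-·-s-reindexed {N} w i = begin
  inversionSum (w · s i)
    ≡⟨ sum-cong-≗ (λ x → sum-cong-≗ (λ y → cong₂ (λ u v → lt x y * 𝟙 (toℕ u <ᵇ toℕ v)) (lookup-w·s y) (lookup-w·s x))) ⟩
  ∑∑ (λ x y → lt x y * c (sw i x) (sw i y))
    ≡⟨ sum-cong-≗ (λ x → sum-cong-≗ (λ y → cong₂ (λ u v → lt u v * c (sw i x) (sw i y)) (sw-involutive i x) (sw-involutive i y))) ⟨
  ∑∑ (λ x y → lt (sw i (sw i x)) (sw i (sw i y)) * c (sw i x) (sw i y))
    ≡⟨ sum-cong-≗ (λ x → ∑-sw i (λ y → lt (sw i (sw i x)) (sw i y) * c (sw i x) y)) ⟩
  ∑∑ (λ x y → lt (sw i (sw i x)) (sw i y) * c (sw i x) y)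
    ≡⟨ ∑-sw i (λ x → ∑[ y < N ] (lt (sw i x) (sw i y) * c x y)) ⟩
  ∑∑ (λ x y → lt (sw i x) (sw i y) * c x y)
    ∎
  where
  open ≡-Reasoning
  ∑∑ : (Fin N → Fin N → ℕ) → ℕ
  ∑∑ f = ∑[ x < N ] ∑[ y < N ] f x y
  lt c : Fin N → Fin N → ℕ
  lt x y = 𝟙 (toℕ x <ᵇ toℕ y)
  c x y = 𝟙 (toℕ (lookup w y) <ᵇ toℕ (lookup w x))
  lookup-w·s : ∀ x → lookup (w · s i) x ≡ lookup w (sw i x)
  lookup-w·s x = trans (lookup-· w (s i) x) (cong (lookup w) (lookup-s i x))

-- After reindexing by sw (suc p), the pairs of values of w are ordered like sw (suc p) i, sw (suc p) j
-- instead of like i, j; the two orders differ only on {P, Q}.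
inversionSum-·-s : ∀ {N} (w : Perm N) p (P Q : Fin N) → toℕ P ≡ p → toℕ Q ≡ suc p
  → inversionSum (w · s (suc p)) + 𝟙 (toℕ (lookup w Q) <ᵇ toℕ (lookup w P))
  ≡ inversionSum w + 𝟙 (toℕ (lookup w P) <ᵇ toℕ (lookup w Q))
inversionSum-·-s {N} w p P Q P≡p Q≡sp = begin
  inversionSum (w · s (suc p)) + c P Q
    ≡⟨ cong₂ _+_ (inversionSum-·-s-reindexed w (suc p)) (sym (∑∑-indicator P Q P≡p Q≡sp c)) ⟩
  ∑∑ (λ i j → lt (σ i) (σ j) * c i j) + ∑∑ (λ i j → δ p i * δ (suc p) j * c i j)
    ≡⟨ ∑∑-distrib-+ (λ i j → lt (σ i) (σ j) * c i j) (λ i j → δ p i * δ (suc p) j * c i j) ⟨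
  ∑∑ (λ i j → lt (σ i) (σ j) * c i j + δ p i * δ (suc p) j * c i j)
    ≡⟨ sum-cong-≗ (λ i → sum-cong-≗ (λ j → pointwise i j)) ⟩
  ∑∑ (λ i j → lt i j * c i j + δ (suc p) i * δ p j * c i j)
    ≡⟨ ∑∑-distrib-+ (λ i j → lt i j * c i j) (λ i j → δ (suc p) i * δ p j * c i j) ⟩
  inversionSum w + ∑∑ (λ i j → δ (suc p) i * δ p j * c i j)
    ≡⟨ cong (inversionSum w +_) (∑∑-indicator Q P Q≡sp P≡p c) ⟩
  inversionSum w + c Q P
    ∎
  where
  open ≡-Reasoning
  σ : Fin N → Fin N
  σ = sw (suc p)
  ∑∑ : (Fin N → Fin N → ℕ) → ℕ
  ∑∑ f = ∑[ i < N ] ∑[ j < N ] f i j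
  lt c : Fin N → Fin N → ℕ
  lt i j = 𝟙 (toℕ i <ᵇ toℕ j)
  c i j = 𝟙 (toℕ (lookup w j) <ᵇ toℕ (lookup w i))
  δ : ℕ → Fin N → ℕ
  δ q i = 𝟙 (toℕ i ≡ᵇ q)
  pointwise : ∀ i j → lt (σ i) (σ j) * c i j + δ p i * δ (suc p) j * c i j ≡ lt i j * c i j + δ (suc p) i * δ p j * c i j
  pointwise i j = begin
    lt (σ i) (σ j) * c i j + δ p i * δ (suc p) j * c i j ≡⟨ *-distribʳ-+ (c i j) (lt (σ i) (σ j)) _ ⟨
    (lt (σ i) (σ j) + δ p i * δ (suc p) j) * c i j       ≡⟨ cong (_* c i j) (sw-<ᵇ p i j (subst (_< N) Q≡sp (toℕ<n Q))) ⟩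
    (lt i j + δ (suc p) i * δ p j) * c i j               ≡⟨ *-distribʳ-+ (c i j) (lt i j) _ ⟩
    lt i j * c i j + δ (suc p) i * δ p j * c i j         ∎

isEvenℕ : ℕ → Bool
isEvenℕ n = n % 2 ≡ᵇ 0

isEvenℕ-suc : ∀ n → isEvenℕ (suc n) ≡ not (isEvenℕ n)
isEvenℕ-suc zero = refl
isEvenℕ-suc (suc n) = trans (sym (not-involutive (isEvenℕ n))) (cong not (sym (isEvenℕ-suc n)))

isEven≡isEvenℕ-inversionSum : ∀ {N} (w : Perm N) → isEven w ≡ isEvenℕ (inversionSum w)
isEven≡isEvenℕ-inversionSum w = cong isEvenℕ (inv≡inversionSum w)

<ᵇ-flip : ∀ {m n} → m ≢ n → (n <ᵇ m) ≡ not (m <ᵇ n)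
<ᵇ-flip {zero} {zero} m≢n = contradiction refl m≢n
<ᵇ-flip {zero} {suc n} _ = refl
<ᵇ-flip {suc m} {zero} _ = refl
<ᵇ-flip {suc m} {suc n} m≢n = <ᵇ-flip (m≢n ∘ cong suc)

isEvenℕ-+𝟙 : ∀ m n x y → m + 𝟙 x ≡ n + 𝟙 y → x ≡ not y → isEvenℕ m ≡ not (isEvenℕ n)
isEvenℕ-+𝟙 m n false true m+0≡n+1 _ = begin
  isEvenℕ m         ≡⟨ cong isEvenℕ (trans (sym (+-identityʳ m)) (trans m+0≡n+1 (+-comm n 1))) ⟩
  isEvenℕ (suc n)   ≡⟨ isEvenℕ-suc n ⟩
  not (isEvenℕ n)   ∎
  where open ≡-Reasoning
isEvenℕ-+𝟙 m n true false m+1≡n+0 _ = begin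
  isEvenℕ m               ≡⟨ not-involutive _ ⟨
  not (not (isEvenℕ m))   ≡⟨ cong not (isEvenℕ-suc m) ⟨
  not (isEvenℕ (suc m))   ≡⟨ cong (not ∘ isEvenℕ) (trans (+-comm 1 m) (trans m+1≡n+0 (+-identityʳ n))) ⟩
  not (isEvenℕ n)         ∎
  where open ≡-Reasoning

isEven-·-s : ∀ {N} (w : Perm N) p → Invertible w → suc p < N → isEven (w · s (suc p)) ≡ not (isEven w)
isEven-·-s {N} w p inv-w sp<N = begin
  isEven (w · s (suc p))               ≡⟨ isEven≡isEvenℕ-inversionSum (w · s (suc p)) ⟩
  isEvenℕ (inversionSum (w · s (suc p))) ≡⟨ isEvenℕ-+𝟙 _ _ _ _ (inversionSum-·-s w p P Q P≡p Q≡sp) (<ᵇ-flip wP≢wQ) ⟩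
  not (isEvenℕ (inversionSum w))       ≡⟨ cong not (isEven≡isEvenℕ-inversionSum w) ⟨
  not (isEven w)                       ∎
  where
  open ≡-Reasoning
  P Q : Fin N
  P = fromℕ< (<-trans (n<1+n p) sp<N)
  Q = fromℕ< sp<N
  P≡p : toℕ P ≡ p
  P≡p = toℕ-fromℕ< _
  Q≡sp : toℕ Q ≡ suc p
  Q≡sp = toℕ-fromℕ< _
  wP≢wQ : toℕ (lookup w P) ≢ toℕ (lookup w Q)
  wP≢wQ wP≡wQ = 1+n≢n (sym (trans (sym P≡p) (trans (cong toℕ (invertible⇒injective inv-w (toℕ-injective wP≡wQ))) Q≡sp)))

𝟙-<ᵇ-asym : ∀ m n → 𝟙 (m <ᵇ n) * 𝟙 (n <ᵇ m) ≡ 0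
𝟙-<ᵇ-asym zero zero = refl
𝟙-<ᵇ-asym zero (suc n) = refl
𝟙-<ᵇ-asym (suc m) zero = refl
𝟙-<ᵇ-asym (suc m) (suc n) = 𝟙-<ᵇ-asym m n

isEven-one : ∀ {N} → isEven (one {N}) ≡ true
isEven-one {N} = trans (isEven≡isEvenℕ-inversionSum (one {N})) (cong isEvenℕ no-inversions)
  where
  no-inversions : inversionSum (one {N}) ≡ 0
  no-inversions = begin
    inversionSum (one {N})
      ≡⟨ sum-cong-≗ {N} (λ i → sum-cong-≗ {N} (λ j → trans (cong₂ (λ x y → 𝟙 (toℕ i <ᵇ toℕ j) * 𝟙 (toℕ x <ᵇ toℕ y)) (lookup-one j) (lookup-one i))
                                                   (𝟙-<ᵇ-asym (toℕ i) (toℕ j)))) ⟩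
    ∑[ i < N ] ∑[ j < N ] 0 ≡⟨ sum-cong-≗ {N} (λ _ → sum-replicate-zero N) ⟩
    ∑[ i < N ] 0            ≡⟨ sum-replicate-zero N ⟩
    0                       ∎
    where open ≡-Reasoning

module _ {N : ℕ} where

  record PreservesParity (r : Perm N) : Set where
    constructor preservesParity
    field
      isEven-·ʳ : ∀ w → Invertible w → isEven (w · r) ≡ isEven w

  open PreservesParity public

  preservesParity-one : PreservesParity one
  preservesParity-one = preservesParity λ w _ → cong isEven (·-identityʳ w)

  preservesParity-· : {u v : Perm N} → Invertible u → PreservesParity u → PreservesParity v → PreservesParity (u · v)
  preservesParity-· {u} {v} inv-u pres-u pres-v = preservesParity λ w inv-w → begin
    isEven (w · (u · v)) ≡⟨ cong isEven (·-assoc w u v) ⟨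
    isEven ((w · u) · v) ≡⟨ isEven-·ʳ pres-v (w · u) (invertible-· inv-w inv-u) ⟩
    isEven (w · u)       ≡⟨ isEven-·ʳ pres-u w inv-w ⟩
    isEven w             ∎
    where open ≡-Reasoning

  preservesParity-s·s : ∀ p q → suc p < N → suc q < N → PreservesParity (s (suc p) · s (suc q))
  preservesParity-s·s p q sp<N sq<N = preservesParity λ w inv-w → begin
    isEven (w · (s (suc p) · s (suc q))) ≡⟨ cong isEven (·-assoc w (s (suc p)) (s (suc q))) ⟨
    isEven ((w · s (suc p)) · s (suc q)) ≡⟨ isEven-·-s (w · s (suc p)) q (invertible-· inv-w (invertible-s (suc p))) sq<N ⟩
    not (isEven (w · s (suc p)))         ≡⟨ cong not (isEven-·-s w p inv-w sp<N) ⟩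
    not (not (isEven w))                 ≡⟨ not-involutive (isEven w) ⟩
    isEven w                             ∎
    where open ≡-Reasoning

  preservesParity-aprod : ∀ j k → suc j < N → PreservesParity (aprod {N} j k)
  preservesParity-aprod j zero _ = preservesParity-one
  preservesParity-aprod j (suc k) sj<N = preservesParity-· (invertible-aprod j k) (preservesParity-aprod j k sj<N)
    (preservesParity-s·s 0 (j ∸ k) (≤-<-trans (s≤s z≤n) sj<N) (≤-<-trans (s≤s (m∸n≤m j k)) sj<N))

  preservesParity-rA : ∀ i k → suc (suc i) < N → PreservesParity (rA {N} (suc i) k)
  preservesParity-rA i k ssi<N = rA-elim PreservesParity (suc i) k (preservesParity-aprod (suc i) k ssi<N)
    (preservesParity-· (invertible-aprod (suc i) i) (preservesParity-aprod (suc i) i ssi<N)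
      (preservesParity-s·s 1 0 (≤-<-trans (s≤s (s≤s z≤n)) ssi<N) (≤-<-trans (s≤s z≤n) ssi<N)))

  preservesParity-prodF-rA : ∀ {m} i (ks : Vec ℕ m) → suc i + m < N → PreservesParity (prodF rA (suc i) ks)
  preservesParity-prodF-rA i [] _ = preservesParity-one
  preservesParity-prodF-rA {suc m} i (k ∷ ks) bound = preservesParity-·
    (invertible-rA (suc i) k)
    (preservesParity-rA i k (≤-<-trans (s≤s (s≤s (m≤m+n i m))) bound′))
    (preservesParity-prodF-rA (suc i) ks bound′)
    where
    bound′ : suc (suc i) + m < N
    bound′ = subst (_< N) (+-suc (suc i) m) bound

isEven-prodF-rA : ∀ m (ks : Vec ℕ m) → isEven (prodF (rA {suc (suc m)}) 1 ks) ≡ true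
isEven-prodF-rA m ks = begin
  isEven w        ≡⟨ cong isEven (·-identityˡ w) ⟨
  isEven (one · w) ≡⟨ isEven-·ʳ (preservesParity-prodF-rA 0 ks ≤-refl) one invertible-one ⟩
  isEven (one {suc (suc m)}) ≡⟨ isEven-one {suc (suc m)} ⟩
  true            ∎
  where
  open ≡-Reasoning
  w : Perm (suc (suc m))
  w = prodF rA 1 ks

length-unique-≡ : ∀ {A : Set} {xs ys : List A} → Unique xs → Unique ys
  → (∀ {z} → z ∈ xs → z ∈ ys) → (∀ {z} → z ∈ ys → z ∈ xs) → length xs ≡ length ys
length-unique-≡ uxs uys xs⊆ys ys⊆xs = ↭-length (∼bag⇒↭ (unique∧set⇒bag uxs uys (mk⇔ xs⊆ys ys⊆xs)))

unique-map-injectiveOn : ∀ {A B : Set} (f : A → B) {xs : List A} → Unique xs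
  → (∀ {x y} → x ∈ xs → y ∈ xs → f x ≡ f y → x ≡ y) → Unique (map f xs)
unique-map-injectiveOn f {[]} _ _ = AllPairs.[]
unique-map-injectiveOn f {x ∷ xs} (x∉xs AllPairs.∷ uxs) inj =
  All.tabulate fx≢ AllPairs.∷ unique-map-injectiveOn f uxs (λ x∈ y∈ → inj (there x∈) (there y∈))
  where
  fx≢ : ∀ {z} → z ∈ map f xs → f x ≢ z
  fx≢ z∈ fx≡z with ∈-map⁻ f z∈
  ... | y , y∈ , refl = All.lookup x∉xs y∈ (inj (here refl) (there y∈) fx≡z)

length-filterᵇ-image : ∀ {A B : Set} (_≟_ : DecidableEquality B) (f : A → B) (P : A → Bool) {xs : List A} {ys : List B}
  → Unique xs → Unique ys → (∀ {x} → x ∈ xs → f x ∈ ys) → (∀ {x y} → x ∈ xs → y ∈ xs → f x ≡ f y → x ≡ y)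
  → length (filterᵇ (λ y → any (λ x → does (f x ≟ y) ∧ P x) xs) ys) ≡ length (filterᵇ P xs)
length-filterᵇ-image {A} {B} _≟_ f P {xs} {ys} uxs uys f∈ys inj = trans
  (length-unique-≡ (Unique.filter⁺ _ uys) (unique-map-injectiveOn f (Unique.filter⁺ _ uxs) (λ x∈ y∈ → inj (in-xs x∈) (in-xs y∈)))
    image⊆ ⊆image)
  (length-map f (filterᵇ P xs))
  where
  hits : B → A → Bool
  hits y x = does (f x ≟ y) ∧ P x
  in-xs : ∀ {x} → x ∈ filterᵇ P xs → x ∈ xs
  in-xs x∈ = proj₁ (∈-filter⁻ (T? ∘ P) {xs = xs} x∈)
  image⊆ : ∀ {y} → y ∈ filterᵇ (λ y → any (hits y) xs) ys → y ∈ map f (filterᵇ P xs)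
  image⊆ {y} y∈ with find (any⁻ (hits y) xs (proj₂ (∈-filter⁻ (T? ∘ (λ y → any (hits y) xs)) {xs = ys} y∈)))
  ... | x , x∈ , hit with Equivalence.to (T-∧ {does (f x ≟ y)} {P x}) hit
  ... | fx≡y , Px = subst (_∈ map f (filterᵇ P xs)) (toWitness {a? = f x ≟ y} (subst T (sym (isYes≗does (f x ≟ y))) fx≡y))
    (∈-map⁺ f (∈-filter⁺ (T? ∘ P) x∈ Px))
  ⊆image : ∀ {y} → y ∈ map f (filterᵇ P xs) → y ∈ filterᵇ (λ y → any (hits y) xs) ys
  ⊆image y∈ with ∈-map⁻ f y∈
  ... | x , x∈ , refl = ∈-filter⁺ (T? ∘ (λ y → any (hits y) xs)) (f∈ys (in-xs x∈))
    (any⁺ (hits (f x)) (lose (in-xs x∈) (Equivalence.from (T-∧ {does (f x ≟ f x)} {P x})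
      (subst T (isYes≗does (f x ≟ f x)) (fromWitness refl) , proj₂ (∈-filter⁻ (T? ∘ P) {xs = xs} x∈)))))

allVecs-suc : ∀ {A : Set} (xs : List A) m → allVecs xs (suc m) ≡ cartesianProductWith (λ v x → x ∷ v) (allVecs xs m) xs
allVecs-suc xs m = concatMap-map≡cartesianProductWith (λ v x → x ∷ v) (allVecs xs m) xs

∈-allVecs : ∀ {A : Set} {xs : List A} → (∀ x → x ∈ xs) → ∀ {m} (v : Vec A m) → v ∈ allVecs xs m
∈-allVecs x∈xs [] = here refl
∈-allVecs {xs = xs} x∈xs {suc m} (x ∷ v) =
  subst (_ ∈_) (sym (allVecs-suc xs m)) (∈-cartesianProductWith⁺ (λ v x → x ∷ v) (∈-allVecs x∈xs v) (x∈xs x))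

allVecs-unique : ∀ {A : Set} {xs : List A} → Unique xs → ∀ m → Unique (allVecs xs m)
allVecs-unique uxs zero = All.[] AllPairs.∷ AllPairs.[]
allVecs-unique {xs = xs} uxs (suc m) = subst Unique (sym (allVecs-suc xs m))
  (Unique.cartesianProductWith⁺ (λ v x → x ∷ v) (swap ∘ ∷-injective) (allVecs-unique uxs m) uxs)

Sym-unique : ∀ N → Unique (Sym N)
Sym-unique N = Unique.filter⁺ _ (allVecs-unique (Unique.allFin⁺ N) N)

Alt-unique : ∀ N → Unique (Alt N)
Alt-unique N = Unique.filter⁺ _ (Sym-unique N)

isPerm-invertible : ∀ {N} {w : Perm N} → Invertible w → T (isPerm w)
isPerm-invertible {N} {w} (mkInvertible w′ _ ww′) = all⁻ _ (All.tabulate {xs = allFin N} λ {y} _ →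
  any⁺ _ (lose (∈-allFin (lookup w′ y)) (subst T (sym (dec-true (y Fin.≟ lookup w (lookup w′ y)) (sym (ww′ y)))) _)))

∈-Sym : ∀ {N} {w : Perm N} → Invertible w → w ∈ Sym N
∈-Sym {N} {w} inv-w = ∈-filter⁺ (T? ∘ isPerm) (∈-allVecs ∈-allFin w) (isPerm-invertible inv-w)

∈-Alt : ∀ {N} {w : Perm N} → Invertible w → isEven w ≡ true → w ∈ Alt N
∈-Alt inv-w even = ∈-filter⁺ (T? ∘ isEven) (∈-Sym inv-w) (Equivalence.from T-≡ even)

wS≡count-tuples : ∀ m (ε : Vec Bool m) → wS (suc m) ε ≡ length (filterᵇ (λ ks → patS 1 ks ==B ε) (tuples suc m))
wS≡count-tuples m ε = length-filterᵇ-image (≡-dec Fin._≟_) (prodF rS 1) (λ ks → patS 1 ks ==B ε)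
  (tuples-unique suc m) (Sym-unique (suc m)) (λ {ks} _ → ∈-Sym (invertible-prodF rS invertible-rS 1 ks)) (prodF-rS-injective m)

wA≡count-tuples : ∀ m (ε : Vec Bool m) → wA (suc m) ε ≡ length (filterᵇ (λ ks → patA 1 ks ==B ε) (tuples (λ j → suc (suc j)) m))
wA≡count-tuples m ε = length-filterᵇ-image (≡-dec Fin._≟_) (prodF rA 1) (λ ks → patA 1 ks ==B ε)
  (tuples-unique _ m) (Alt-unique (suc (suc m)))
  (λ {ks} _ → ∈-Alt (invertible-prodF rA invertible-rA 1 ks) (isEven-prodF-rA m ks)) (prodF-rA-injective m)

weightProd-∷ʳ : ∀ wt {m} j (es : Vec Bool m) e → weightProd wt j (es ∷ʳ e) ≡ weightProd wt j es * wt (j + m) e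
weightProd-∷ʳ wt j [] e = begin
  wt j e * 1        ≡⟨ *-identityʳ (wt j e) ⟩
  wt j e            ≡⟨ cong (λ i → wt i e) (+-identityʳ j) ⟨
  wt (j + 0) e      ≡⟨ +-identityʳ _ ⟨
  1 * wt (j + 0) e  ∎
  where open ≡-Reasoning
weightProd-∷ʳ wt {suc m} j (e₀ ∷ es) e = begin
  wt j e₀ * weightProd wt (suc j) (es ∷ʳ e)                  ≡⟨ cong (wt j e₀ *_) (weightProd-∷ʳ wt (suc j) es e) ⟩
  wt j e₀ * (weightProd wt (suc j) es * wt (suc j + m) e)    ≡⟨ *-assoc (wt j e₀) _ _ ⟨
  weightProd wt j (e₀ ∷ es) * wt (suc (j + m)) e             ≡⟨ cong (λ i → weightProd wt j (e₀ ∷ es) * wt i e) (+-suc j m) ⟨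
  weightProd wt j (e₀ ∷ es) * wt (j + suc m) e               ∎
  where open ≡-Reasoning

length-filterᵇ-map : ∀ {A B : Set} (p : B → Bool) (g : A → B) (xs : List A)
  → length (filterᵇ p (map g xs)) ≡ length (filterᵇ (p ∘ g) xs)
length-filterᵇ-map p g [] = refl
length-filterᵇ-map p g (x ∷ xs) with p (g x)
... | true = cong suc (length-filterᵇ-map p g xs)
... | false = length-filterᵇ-map p g xs

length-filterᵇ-cartesianProductWith : ∀ {A B C : Set} (f : A → B → C) (p : C → Bool) (P : A → Bool) (Q : B → Bool)
  → (∀ x y → p (f x y) ≡ P x ∧ Q y) → ∀ xs ys
  → length (filterᵇ p (cartesianProductWith f xs ys)) ≡ length (filterᵇ P xs) * length (filterᵇ Q ys)
length-filterᵇ-cartesianProductWith f p P Q p≡ [] ys = refl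
length-filterᵇ-cartesianProductWith {B = B} f p P Q p≡ (x ∷ xs) ys = begin
  length (filterᵇ p (map (f x) ys ++ cartesianProductWith f xs ys))
    ≡⟨ length-filterᵇ-++ p (map (f x) ys) _ ⟩
  length (filterᵇ p (map (f x) ys)) + length (filterᵇ p (cartesianProductWith f xs ys))
    ≡⟨ cong₂ _+_ (length-filterᵇ-map p (f x) ys) (length-filterᵇ-cartesianProductWith f p P Q p≡ xs ys) ⟩
  length (filterᵇ (p ∘ f x) ys) + length (filterᵇ P xs) * length (filterᵇ Q ys)
    ≡⟨ cong (_+ _) (cong length (filterᵇ-cong (p≡ x) ys)) ⟩
  length (filterᵇ (λ y → P x ∧ Q y) ys) + length (filterᵇ P xs) * length (filterᵇ Q ys)
    ≡⟨ first-row ⟩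
  length (filterᵇ P (x ∷ xs)) * length (filterᵇ Q ys)
    ∎
  where
  open ≡-Reasoning
  filterᵇ-cong : ∀ {q r : B → Bool} → (∀ y → q y ≡ r y) → ∀ zs → filterᵇ q zs ≡ filterᵇ r zs
  filterᵇ-cong q≗r [] = refl
  filterᵇ-cong {q} {r} q≗r (z ∷ zs) rewrite q≗r z with r z
  ... | true = cong (z ∷_) (filterᵇ-cong q≗r zs)
  ... | false = filterᵇ-cong q≗r zs
  filterᵇ-false : ∀ zs → length (filterᵇ (λ (_ : B) → false) zs) ≡ 0
  filterᵇ-false [] = refl
  filterᵇ-false (_ ∷ zs) = filterᵇ-false zs
  first-row : length (filterᵇ (λ y → P x ∧ Q y) ys) + length (filterᵇ P xs) * length (filterᵇ Q ys)
    ≡ length (filterᵇ P (x ∷ xs)) * length (filterᵇ Q ys)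
  first-row with P x
  ... | true = refl
  ... | false = cong (_+ length (filterᵇ P xs) * length (filterᵇ Q ys)) (filterᵇ-false ys)

==B-∷ʳ : ∀ {m} (u v : Vec Bool m) x y → (u ∷ʳ x) ==B (v ∷ʳ y) ≡ (u ==B v) ∧ does (x Bool.≟ y)
==B-∷ʳ [] [] x y = ∧-identityʳ (does (x Bool.≟ y))
==B-∷ʳ (x₀ ∷ u) (y₀ ∷ v) x y = begin
  does (x₀ Bool.≟ y₀) ∧ ((u ∷ʳ x) ==B (v ∷ʳ y))          ≡⟨ cong (does (x₀ Bool.≟ y₀) ∧_) (==B-∷ʳ u v x y) ⟩
  does (x₀ Bool.≟ y₀) ∧ ((u ==B v) ∧ does (x Bool.≟ y))  ≡⟨ ∧-assoc (does (x₀ Bool.≟ y₀)) _ _ ⟨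
  (does (x₀ Bool.≟ y₀) ∧ (u ==B v)) ∧ does (x Bool.≟ y)  ∎
  where open ≡-Reasoning

patS-∷ʳ : ∀ {m} j (ks : Vec ℕ m) k → patS j (ks ∷ʳ k) ≡ patS j ks ∷ʳ (k ≡ᵇ j + m)
patS-∷ʳ j [] k = cong (λ i → (k ≡ᵇ i) ∷ []) (sym (+-identityʳ j))
patS-∷ʳ {suc m} j (k₀ ∷ ks) k = cong ((k₀ ≡ᵇ j) ∷_)
  (trans (patS-∷ʳ (suc j) ks k) (cong (λ i → patS (suc j) ks ∷ʳ (k ≡ᵇ i)) (sym (+-suc j m))))

patA-∷ʳ : ∀ {m} j (ks : Vec ℕ m) k → patA j (ks ∷ʳ k) ≡ patA j ks ∷ʳ (j + m ≤ᵇ k)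
patA-∷ʳ j [] k = cong (λ i → (i ≤ᵇ k) ∷ []) (sym (+-identityʳ j))
patA-∷ʳ {suc m} j (k₀ ∷ ks) k = cong ((j ≤ᵇ k₀) ∷_)
  (trans (patA-∷ʳ (suc j) ks k) (cong (λ i → patA (suc j) ks ∷ʳ (i ≤ᵇ k)) (sym (+-suc j m))))

module PatternCount (b : ℕ → ℕ) (bit : ℕ → ℕ → Bool) (pat : ∀ {m} → Vec ℕ m → Vec Bool m)
  (pat-∷ʳ : ∀ {m} (ks : Vec ℕ m) k → pat (ks ∷ʳ k) ≡ pat ks ∷ʳ bit (suc m) k) where

  weight : ℕ → Bool → ℕ
  weight j e = length (filterᵇ (λ k → does (bit j k Bool.≟ e)) (upTo (b j)))

  length-filterᵇ-pattern : ∀ m (ε : Vec Bool m) → length (filterᵇ (λ ks → pat ks ==B ε) (tuples b m)) ≡ weightProd weight 1 ε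
  length-filterᵇ-pattern zero [] with pat []
  ... | [] = refl
  length-filterᵇ-pattern (suc m) ε with initLast ε
  ... | ε′ , e , refl = begin
    length (filterᵇ (λ ks → pat ks ==B (ε′ ∷ʳ e)) (tuples b (suc m)))
      ≡⟨ cong (length ∘ filterᵇ _) (tuples-suc b m) ⟩
    length (filterᵇ (λ ks → pat ks ==B (ε′ ∷ʳ e)) (cartesianProductWith _∷ʳ_ (tuples b m) (upTo (b (suc m)))))
      ≡⟨ length-filterᵇ-cartesianProductWith _∷ʳ_ _ (λ ks → pat ks ==B ε′) (λ k → does (bit (suc m) k Bool.≟ e)) split
           (tuples b m) (upTo (b (suc m))) ⟩
    length (filterᵇ (λ ks → pat ks ==B ε′) (tuples b m)) * weight (suc m) e
      ≡⟨ cong (_* weight (suc m) e) (length-filterᵇ-pattern m ε′) ⟩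
    weightProd weight 1 ε′ * weight (suc m) e
      ≡⟨ weightProd-∷ʳ weight 1 ε′ e ⟨
    weightProd weight 1 (ε′ ∷ʳ e)
      ∎
    where
    open ≡-Reasoning
    split : ∀ ks k → pat (ks ∷ʳ k) ==B (ε′ ∷ʳ e) ≡ (pat ks ==B ε′) ∧ does (bit (suc m) k Bool.≟ e)
    split ks k = trans (cong (_==B (ε′ ∷ʳ e)) (pat-∷ʳ ks k)) (==B-∷ʳ (pat ks) ε′ _ e)

length-filterᵇ-upTo-suc : ∀ (p : ℕ → Bool) n → length (filterᵇ p (upTo (suc n))) ≡ length (filterᵇ p (upTo n)) + 𝟙 (p n)
length-filterᵇ-upTo-suc p n = begin
  length (filterᵇ p (upTo (suc n)))                         ≡⟨ cong (length ∘ filterᵇ p) (upTo-∷ʳ n) ⟨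
  length (filterᵇ p (upTo n ++ n ∷ []))                      ≡⟨ length-filterᵇ-++ p (upTo n) (n ∷ []) ⟩
  length (filterᵇ p (upTo n)) + length (filterᵇ p (n ∷ []))  ≡⟨ cong (length (filterᵇ p (upTo n)) +_) (singleton (p n) refl) ⟩
  length (filterᵇ p (upTo n)) + 𝟙 (p n)                     ∎
  where
  open ≡-Reasoning
  singleton : ∀ b → p n ≡ b → length (filterᵇ p (n ∷ [])) ≡ 𝟙 b
  singleton b refl with p n
  ... | true = refl
  ... | false = refl

length-filterᵇ-upTo-const : ∀ (p : ℕ → Bool) n b → (∀ k → k < n → p k ≡ b)
  → length (filterᵇ p (upTo n)) ≡ (if b then n else 0)
length-filterᵇ-upTo-const p zero true _ = refl
length-filterᵇ-upTo-const p zero false _ = refl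
length-filterᵇ-upTo-const p (suc n) b p≡b = begin
  length (filterᵇ p (upTo (suc n)))      ≡⟨ length-filterᵇ-upTo-suc p n ⟩
  length (filterᵇ p (upTo n)) + 𝟙 (p n)
    ≡⟨ cong₂ _+_ (length-filterᵇ-upTo-const p n b (λ k k<n → p≡b k (m<n⇒m<1+n k<n))) (cong 𝟙 (p≡b n ≤-refl)) ⟩
  (if b then n else 0) + 𝟙 b             ≡⟨ last b ⟩
  (if b then suc n else 0)               ∎
  where
  open ≡-Reasoning
  last : ∀ b → (if b then n else 0) + 𝟙 b ≡ (if b then suc n else 0)
  last true = +-comm n 1
  last false = refl

does-true-≟ : ∀ e → does (true Bool.≟ e) ≡ e
does-true-≟ true = refl
does-true-≟ false = refl

does-false-≟ : ∀ e → does (false Bool.≟ e) ≡ not e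
does-false-≟ true = refl
does-false-≟ false = refl

module PatternS = PatternCount suc (λ j k → k ≡ᵇ j) (patS 1) (patS-∷ʳ 1)
module PatternA = PatternCount (λ j → suc (suc j)) (λ j k → j ≤ᵇ k) (patA 1) (patA-∷ʳ 1)

S-weight : ∀ j e → PatternS.weight j e ≡ (if e then 1 else j)
S-weight j e = begin
  length (filterᵇ q (upTo (suc j)))                   ≡⟨ length-filterᵇ-upTo-suc q j ⟩
  length (filterᵇ q (upTo j)) + 𝟙 (q j)               ≡⟨ cong₂ _+_ (length-filterᵇ-upTo-const q j (not e) below) (cong 𝟙 at-j) ⟩
  (if not e then j else 0) + 𝟙 e                      ≡⟨ total e ⟩
  (if e then 1 else j)                                ∎
  where
  open ≡-Reasoning
  q : ℕ → Bool
  q k = does ((k ≡ᵇ j) Bool.≟ e)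
  below : ∀ k → k < j → q k ≡ not e
  below k k<j = trans (cong (λ b → does (b Bool.≟ e)) (dec-false (k ≟ j) (<⇒≢ k<j))) (does-false-≟ e)
  at-j : q j ≡ e
  at-j = trans (cong (λ b → does (b Bool.≟ e)) (dec-true (j ≟ j) refl)) (does-true-≟ e)
  total : ∀ e → (if not e then j else 0) + 𝟙 e ≡ (if e then 1 else j)
  total true = refl
  total false = +-identityʳ j

A-weight : ∀ j e → PatternA.weight j e ≡ (if e then 2 else j)
A-weight j e = begin
  length (filterᵇ q (upTo (suc (suc j))))                      ≡⟨ length-filterᵇ-upTo-suc q (suc j) ⟩
  length (filterᵇ q (upTo (suc j))) + 𝟙 (q (suc j))            ≡⟨ cong (_+ 𝟙 (q (suc j))) (length-filterᵇ-upTo-suc q j) ⟩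
  length (filterᵇ q (upTo j)) + 𝟙 (q j) + 𝟙 (q (suc j))
    ≡⟨ cong₂ _+_ (cong₂ _+_ (length-filterᵇ-upTo-const q j (not e) below) (cong 𝟙 (at j ≤-refl))) (cong 𝟙 (at (suc j) (n≤1+n j))) ⟩
  (if not e then j else 0) + 𝟙 e + 𝟙 e                         ≡⟨ total e ⟩
  (if e then 2 else j)                                         ∎
  where
  open ≡-Reasoning
  q : ℕ → Bool
  q k = does ((j ≤ᵇ k) Bool.≟ e)
  below : ∀ k → k < j → q k ≡ not e
  below k k<j = trans (cong (λ b → does (b Bool.≟ e)) (dec-false (j ≤? k) (<⇒≱ k<j))) (does-false-≟ e)
  at : ∀ k → j ≤ k → q k ≡ e
  at k j≤k = trans (cong (λ b → does (b Bool.≟ e)) (dec-true (j ≤? k) j≤k)) (does-true-≟ e)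
  total : ∀ e → (if not e then j else 0) + 𝟙 e + 𝟙 e ≡ (if e then 2 else j)
  total true = refl
  total false = trans (+-identityʳ (j + 0)) (+-identityʳ j)

proposition5p12 : ∀ {c ℓ} (R : CommutativeSemiring c ℓ) (n : ℕ) → 1 ≤ n
    → (t : Vec (CommutativeSemiring.Carrier R) (n ∸ 1))
    → CommutativeSemiring._≈_ R (GF.genFun R n (wS n) t) (GF.prodS R 1 t)
      × CommutativeSemiring._≈_ R (GF.genFun R n (wA n) t) (GF.prodA R 1 t)
proposition5p12 R (suc m) _ t =
  Expansion.genFun-prodS R m (wS (suc m)) PatternS.weight wS≡weightProd S-weight t ,
  Expansion.genFun-prodA R m (wA (suc m)) PatternA.weight wA≡weightProd A-weight t
  where
  wS≡weightProd : ∀ ε → wS (suc m) ε ≡ weightProd PatternS.weight 1 ε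
  wS≡weightProd ε = trans (wS≡count-tuples m ε) (PatternS.length-filterᵇ-pattern m ε)
  wA≡weightProd : ∀ ε → wA (suc m) ε ≡ weightProd PatternA.weight 1 ε
  wA≡weightProd ε = trans (wA≡count-tuples m ε) (PatternA.length-filterᵇ-pattern m ε)
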